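{- Let $G$ be a unicyclic graph and $C_p$ the cycle in $G$. If $p\ge 4$, then $2\le \chi_i'(G)\le 4$.
   Context: A unicyclic graph is a connected simple graph with exactly one cycle. Three edges $e_1,e_2,e_3$ (in this order) are consecutive if $e_1=xy$, $e_2=yz$, $e_3=zu$ for some vertices $x,y,z,u$ (where $x=u$ is allowed). An injective edge coloring of $G$ is a map $c:E(G)\to\mathcal{C}$ such that whenever $e_1,e_2,e_3$ are consecutive edges, $c(e_1)\neq c(e_3)$. $\chi_i'(G)$ is the minimum number of colors in an injective edge coloring of $G$. -}

module Defs where

open import Data.Nat using (ℕ; zero; suc; _≤_; _<_)
open import Data.Nat.DivMod using (_%_; m%n<n)
open import Data.Fin using (Fin; toℕ; fromℕ<)
open import Data.Bool using (Bool; true; false)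
open import Data.List using (List; []; _∷_)
open import Data.Product using (Σ; _×_; _,_; ∃; ∃-syntax)
open import Data.Sum using (_⊎_)
open import Relation.Binary.PropositionalEquality using (_≡_; _≢_)
open import Relation.Nullary using (¬_)
open import Function.Definitions using (Injective)

record Graph : Set where
  field
    n    : ℕ
    adj  : Fin n → Fin n → Bool
    sym  : ∀ x y → adj x y ≡ adj y x
    irr  : ∀ x → adj x x ≡ false

open Graph public

Adj : (G : Graph) → Fin (n G) → Fin (n G) → Set
Adj G x y = adj G x y ≡ true

data Walk (G : Graph) : Fin (n G) → Fin (n G) → Set where
  here : ∀ {u} → Walk G u u
  step : ∀ {u w v} → Adj G u w → Walk G w v → Walk G u v

Connected : Graph → Set
Connected G = ∀ (u v : Fin (n G)) → Walk G u v

cnext : ∀ {m} → Fin (suc m) → Fin (suc m)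
cnext {m} i = fromℕ< (m%n<n (suc (toℕ i)) (suc m))

record Cycle (G : Graph) : Set where
  field
    m      : ℕ
    len≥3  : 3 ≤ suc m
    vtx    : Fin (suc m) → Fin (n G)
    inj    : Injective _≡_ _≡_ vtx
    closed : ∀ i → Adj G (vtx i) (vtx (cnext i))

open Cycle public

len : ∀ {G} → Cycle G → ℕ
len C = suc (m C)

CycleEdge : ∀ {G} → Cycle G → Fin (n G) → Fin (n G) → Set
CycleEdge C x y =
  ∃[ i ] ((x ≡ vtx C i × y ≡ vtx C (cnext i)) ⊎ (y ≡ vtx C i × x ≡ vtx C (cnext i)))

-- two cycles are the same cycle (same subgraph) iff they have the same edges
SameCycle : ∀ {G} → Cycle G → Cycle G → Set
SameCycle {G} C D = ∀ (x y : Fin (n G)) →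
  (CycleEdge C x y → CycleEdge D x y) × (CycleEdge D x y → CycleEdge C x y)

UnicyclicWith : (G : Graph) → Cycle G → Set
UnicyclicWith G C = Connected G × (∀ (D : Cycle G) → SameCycle C D)

-- An edge colouring with k colours, given as a symmetric function on
-- vertex pairs (only values on adjacent pairs matter): edge xy gets c x y.
record EdgeColouring (G : Graph) (k : ℕ) : Set where
  field
    col  : Fin (n G) → Fin (n G) → Fin k
    csym : ∀ x y → col x y ≡ col y x

open EdgeColouring public

-- Injective: for consecutive (distinct) edges xy, yz, zu, colours of xy and zu differ.
-- x ≢ z makes xy ≠ yz, y ≢ u makes yz ≠ zu; x = u is allowed.
IsInjective : ∀ {G k} → EdgeColouring G k → Set
IsInjective {G} c = ∀ (x y z u : Fin (n G)) →
  Adj G x y → Adj G y z → Adj G z u → x ≢ z → y ≢ u →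
  col c x y ≢ col c z u

HasInjColouring : Graph → ℕ → Set
HasInjColouring G k = Σ (EdgeColouring G k) IsInjective

module Submission where

-- Lower bound: three consecutive edges v₀v₁, v₁v₂, v₂v₃ of C must have
-- their first and last colours different, so one colour never suffices.
--
-- Upper bound: orient G as a forest hanging from C.  Every vertex v gets a
-- parent π v: off the cycle the first step of a shortest walk to C, on the
-- cycle the predecessor vᵢ ↦ vᵢ₋₁.  Because C is the only cycle, every edge
-- of G is of the form {v, π v} (otherwise loop-erasing the walk through
-- the roots would close a second cycle).  Colour the edge {v, π v} by a
-- vertex colour c v.  Consecutive edges then have ends at "grandparent" or
-- "uncle" distance, and the colouring is injective as soon as
--   c a ≠ c (π (π a))   and   π a = π (π b), a ≠ π b ⇒ c a ≠ c b.
-- Such a c is obtained from the position of v (root index i on C and depth d)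
-- through a colour scheme for the cycle: seven finitely checkable
-- constraints on a table Fin p → ℕ → Fin 4.  A scheme with four colours is
-- built from a 3-periodic pattern along C patched at indices 0 and 1 to
-- close up the cycle whatever p mod 3 is.

open import Defs hiding (sym)
open import Data.Nat using (ℕ; zero; suc; _+_; _≤_; _<_; z≤n; s≤s; s≤s⁻¹)
open import Data.Nat.Properties
  using (≤-antisym; ≮⇒≥; m≤n⇒m<n∨m≡n; n<1+n; n≤0⇒n≡0; +-suc; +-identityʳ; suc-injective)
open import Data.Nat.DivMod using (_%_; m%n<n; m<n⇒m%n≡m; n%n≡0)
open import Data.Fin using (Fin; zero; suc; toℕ; fromℕ; inject₁; _≟_)
open import Data.Fin.Patterns using (0F; 1F; 2F; 3F)
open import Data.Fin.Properties
  using (toℕ-injective; toℕ-fromℕ<; toℕ-fromℕ; toℕ-inject₁; toℕ<n; toℕ≤pred[n]; any?; all?)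
open import Data.Bool using (true) renaming (_≟_ to _≟ᵇ_)
open import Data.List using (List; []; _∷_; _++_; length; lookup)
open import Data.List.Relation.Unary.All as All using (All; []; _∷_)
open import Data.List.Relation.Unary.Linked as Linked using (Linked; []; [-]; _∷_)
open import Data.List.Relation.Unary.Unique.Propositional using (Unique; []; _∷_)
open import Data.List.Membership.Propositional.Properties using (∈-lookup)
open import Data.Maybe using (Maybe; just; nothing)
open import Data.Product using (∃-syntax; _×_; _,_; proj₁; proj₂)
open import Data.Sum using (_⊎_; inj₁; inj₂)
open import Data.Empty using (⊥; ⊥-elim)
open import Relation.Binary.Definitions using (DecidableEquality)
open import Relation.Binary.PropositionalEquality
  using (_≡_; _≢_; refl; sym; trans; cong; cong₂; subst; module ≡-Reasoning)
open import Relation.Nullary using (¬_; Dec; yes; no; ¬?)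
open import Relation.Nullary.Decidable using (_×-dec_; _⊎-dec_; from-yes)
open import Function using (case_of_)

open ≡-Reasoning

cprev : ∀ {m} → Fin (suc m) → Fin (suc m)
cprev {m} zero = fromℕ m
cprev (suc j) = inject₁ j

toℕ-cnext : ∀ {m} (i : Fin (suc m)) → toℕ (cnext i) ≡ suc (toℕ i) % suc m
toℕ-cnext {m} i = toℕ-fromℕ< (m%n<n (suc (toℕ i)) (suc m))

cnext-below-last : ∀ {m} (i : Fin (suc m)) → toℕ i < m → toℕ (cnext i) ≡ suc (toℕ i)
cnext-below-last i i<m = trans (toℕ-cnext i) (m<n⇒m%n≡m (s≤s i<m))

cnext-last : ∀ {m} (i : Fin (suc m)) → toℕ i ≡ m → cnext i ≡ zero
cnext-last {m} i i≡m =
  toℕ-injective (trans (toℕ-cnext i) (trans (cong (λ k → suc k % suc m) i≡m) (n%n≡0 (suc m))))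

cnext-cprev : ∀ {m} (j : Fin (suc m)) → cnext (cprev j) ≡ j
cnext-cprev {m} zero = cnext-last (fromℕ m) (toℕ-fromℕ m)
cnext-cprev {suc m} (suc j) = toℕ-injective (begin
  toℕ (cnext (inject₁ j))  ≡⟨ cnext-below-last (inject₁ j) (subst (_< suc m) (sym (toℕ-inject₁ j)) (toℕ<n j)) ⟩
  suc (toℕ (inject₁ j))    ≡⟨ cong suc (toℕ-inject₁ j) ⟩
  suc (toℕ j)              ∎)

cprev-cnext : ∀ {m} (i : Fin (suc m)) → cprev (cnext i) ≡ i
cprev-cnext {m} i with m≤n⇒m<n∨m≡n (toℕ≤pred[n] i)
... | inj₂ i≡m rewrite cnext-last i i≡m = toℕ-injective (trans (toℕ-fromℕ m) (sym i≡m))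
... | inj₁ i<m = predecessor (cnext i) (cnext-below-last i i<m)
  where
  predecessor : (j : Fin (suc m)) → toℕ j ≡ suc (toℕ i) → cprev j ≡ i
  predecessor (suc j) e = toℕ-injective (trans (toℕ-inject₁ j) (suc-injective e))

record Least (P : ℕ → Set) : Set where
  field
    value : ℕ
    holds : P value
    below : ∀ {j} → j < value → ¬ P j

least : {P : ℕ → Set} → (∀ k → Dec (P k)) → ∀ {k} → P k → Least P
least {P} P? {k} pk = search k 0 (λ ()) (subst P (sym (+-identityʳ k)) pk)
  where
  search : ∀ fuel s → (∀ {j} → j < s → ¬ P j) → P (fuel + s) → Least P
  search zero s none p = record { value = s ; holds = p ; below = none }
  search (suc fuel) s none p with P? s
  ... | yes ps = record { value = s ; holds = ps ; below = none }
  ... | no ¬ps = search fuel (suc s) none′ (subst P (sym (+-suc fuel s)) p)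
    where
    none′ : ∀ {j} → j < suc s → ¬ P j
    none′ j<1+s with m≤n⇒m<n∨m≡n (s≤s⁻¹ j<1+s)
    ... | inj₁ j<s = none j<s
    ... | inj₂ refl = ¬ps

-- A walk is a list h ∷ t with consecutive entries related (Linked R (h ∷ t));
-- end h t is its last vertex.
end : ∀ {A : Set} → A → List A → A
end h [] = h
end h (y ∷ ys) = end y ys

end-++ : ∀ {A : Set} (h : A) t t′ → end h (t ++ t′) ≡ end (end h t) t′
end-++ h [] t′ = refl
end-++ h (y ∷ t) t′ = end-++ y t t′

linked-++ : ∀ {A : Set} {R : A → A → Set} {h} t {t′} →
            Linked R (h ∷ t) → Linked R (end h t ∷ t′) → Linked R (h ∷ t ++ t′)
linked-++ [] [-] w′ = w′
linked-++ (y ∷ t) (r ∷ w) w′ = r ∷ linked-++ t w w′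

linked-lookup : ∀ {A : Set} {R : A → A → Set} {xs} → Linked R xs →
                ∀ i j → toℕ j ≡ suc (toℕ i) → R (lookup xs i) (lookup xs j)
linked-lookup [-] zero zero ()
linked-lookup (r ∷ w) zero zero ()
linked-lookup (r ∷ w) zero (suc zero) _ = r
linked-lookup (r ∷ w) zero (suc (suc j)) ()
linked-lookup (r ∷ w) (suc i) zero ()
linked-lookup (r ∷ w) (suc i) (suc j) e = linked-lookup w i j (suc-injective e)

end-lookup : ∀ {A : Set} (h : A) t (i : Fin (suc (length t))) → toℕ i ≡ length t →
             lookup (h ∷ t) i ≡ end h t
end-lookup h [] zero _ = refl
end-lookup h (y ∷ t) (suc i) e = end-lookup y t i (suc-injective e)

unique-lookup-injective : ∀ {A : Set} {xs : List A} → Unique xs →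
                          ∀ i j → lookup xs i ≡ lookup xs j → i ≡ j
unique-lookup-injective (_ ∷ _) zero zero _ = refl
unique-lookup-injective (x∉ ∷ _) zero (suc j) e = ⊥-elim (All.lookup x∉ (∈-lookup j) e)
unique-lookup-injective (x∉ ∷ _) (suc i) zero e = ⊥-elim (All.lookup x∉ (∈-lookup i) (sym e))
unique-lookup-injective (_ ∷ u) (suc i) (suc j) e = cong suc (unique-lookup-injective u i j e)

module LoopErasure {A : Set} (_≟ᴬ_ : DecidableEquality A) {R : A → A → Set} where

  after : A → List A → Maybe (List A)
  after h [] = nothing
  after h (y ∷ t) with h ≟ᴬ y
  ... | yes _ = just t
  ... | no _ = after h t

  after-just : ∀ {h y t s} → after h (y ∷ t) ≡ just s → Linked R (y ∷ t) → Unique (y ∷ t) →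
               Linked R (h ∷ s) × Unique (h ∷ s) × end h s ≡ end y t
  after-just {h} {y} {t} e w u with h ≟ᴬ y
  after-just refl w u | yes refl = w , u , refl
  after-just {t = z ∷ t} e (_ ∷ w) (_ ∷ u) | no _ = after-just e w u

  after-nothing : ∀ {h} t → after h t ≡ nothing → All (h ≢_) t
  after-nothing [] _ = []
  after-nothing {h} (y ∷ t) e with h ≟ᴬ y
  ... | no h≢y = h≢y ∷ after-nothing t e

  loopErase : A → List A → List A
  loopErase h [] = []
  loopErase h (y ∷ ys) with after h (y ∷ loopErase y ys)
  ... | just s = s
  ... | nothing = y ∷ loopErase y ys

  loopErase-simple : ∀ h t → Linked R (h ∷ t) →
    Linked R (h ∷ loopErase h t) × Unique (h ∷ loopErase h t) × end h (loopErase h t) ≡ end h t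
  loopErase-simple h [] [-] = [-] , [] ∷ [] , refl
  loopErase-simple h (y ∷ ys) (r ∷ w)
    with loopErase-simple y ys w | after h (y ∷ loopErase y ys) in found
  ... | w′ , u′ , e′ | just s = let (w″ , u″ , e″) = after-just found w′ u′ in w″ , u″ , trans e″ e′
  ... | w′ , u′ , e′ | nothing = r ∷ w′ , after-nothing (y ∷ loopErase y ys) found ∷ u′ , e′

adj-sym : ∀ (G : Graph) {x y} → Adj G x y → Adj G y x
adj-sym G {x} {y} xy = trans (Graph.sym G y x) xy

adj-irrefl : ∀ (G : Graph) {x y} → Adj G x y → x ≢ y
adj-irrefl G {x} xy refl with trans (sym xy) (irr G x)
... | ()

module ClosePath (G : Graph) {h : Fin (n G)} (t : List (Fin (n G)))
  (walk : Linked (Adj G) (h ∷ t)) (simple : Unique (h ∷ t))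
  (closing : Adj G (end h t) h) (long : 2 ≤ length t) where

  closed-walk : ∀ i → Adj G (lookup (h ∷ t) i) (lookup (h ∷ t) (cnext i))
  closed-walk i with m≤n⇒m<n∨m≡n (toℕ≤pred[n] i)
  ... | inj₁ i<last = linked-lookup walk i (cnext i) (cnext-below-last i i<last)
  ... | inj₂ i≡last rewrite cnext-last i i≡last =
    subst (λ x → Adj G x h) (sym (end-lookup h t i i≡last)) closing

  cycle : Cycle G
  cycle = record
    { m      = length t
    ; len≥3  = s≤s long
    ; vtx    = lookup (h ∷ t)
    ; inj    = λ {i} {j} → unique-lookup-injective simple i j
    ; closed = closed-walk }

  closing-edge : CycleEdge cycle h (end h t)
  closing-edge = last , inj₂ (sym (end-lookup h t last (toℕ-fromℕ (length t))) ,
                              cong (lookup (h ∷ t)) (sym (cnext-last last (toℕ-fromℕ (length t)))))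
    where
    last : Fin (suc (length t))
    last = fromℕ (length t)

record CycleForest (G : Graph) (C : Cycle G) : Set where
  field
    parent       : Fin (n G) → Fin (n G)
    depth        : Fin (n G) → ℕ
    parent-adj   : ∀ v → Adj G v (parent v)
    parent-cycle : ∀ i → parent (vtx C i) ≡ vtx C (cprev i)
    depth-cycle  : ∀ i → depth (vtx C i) ≡ 0
    depth-zero   : ∀ v → depth v ≡ 0 → ∃[ i ] vtx C i ≡ v
    depth-parent : ∀ v {k} → depth v ≡ suc k → depth (parent v) ≡ k

module Forest {G : Graph} {C : Cycle G} (F : CycleForest G C) where
  open CycleForest F

  ancestor : ℕ → Fin (n G) → Fin (n G)
  ancestor zero v = v
  ancestor (suc k) v = ancestor k (parent v)

  ancestor-depth : ∀ k v → depth v ≡ k → depth (ancestor k v) ≡ 0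
  ancestor-depth zero v d = d
  ancestor-depth (suc k) v d = ancestor-depth k (parent v) (depth-parent v d)

  root : Fin (n G) → Fin (suc (m C))
  root v = proj₁ (depth-zero (ancestor (depth v) v) (ancestor-depth (depth v) v refl))

  root-spec : ∀ v → vtx C (root v) ≡ ancestor (depth v) v
  root-spec v = proj₂ (depth-zero (ancestor (depth v) v) (ancestor-depth (depth v) v refl))

  on-cycle : ∀ v → depth v ≡ 0 → vtx C (root v) ≡ v
  on-cycle v d = trans (root-spec v) (cong (λ k → ancestor k v) d)

  root-cycle : ∀ i → root (vtx C i) ≡ i
  root-cycle i = inj C (on-cycle (vtx C i) (depth-cycle i))

  root-parent : ∀ v {k} → depth v ≡ suc k → root (parent v) ≡ root v
  root-parent v {k} d = inj C (begin
    vtx C (root (parent v))                ≡⟨ root-spec (parent v) ⟩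
    ancestor (depth (parent v)) (parent v) ≡⟨ cong (λ j → ancestor j (parent v)) (depth-parent v d) ⟩
    ancestor (suc k) v                     ≡⟨ cong (λ j → ancestor j v) (sym d) ⟩
    ancestor (depth v) v                   ≡⟨ sym (root-spec v) ⟩
    vtx C (root v)                         ∎)

  child-of-cycle : ∀ v j → parent v ≡ vtx C j → v ≡ vtx C (cnext j) ⊎ (depth v ≡ 1 × root v ≡ j)
  child-of-cycle v j p = by-depth (depth v) refl
    where
    by-depth : ∀ d → depth v ≡ d → v ≡ vtx C (cnext j) ⊎ (depth v ≡ 1 × root v ≡ j)
    by-depth zero dv = inj₁ (begin
      v                              ≡⟨ sym (on-cycle v dv) ⟩
      vtx C (root v)                 ≡⟨ cong (vtx C) (sym (cnext-cprev (root v))) ⟩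
      vtx C (cnext (cprev (root v))) ≡⟨ cong (λ i → vtx C (cnext i)) cprev-root ⟩
      vtx C (cnext j)                ∎)
      where
      cprev-root : cprev (root v) ≡ j
      cprev-root = inj C (begin
        vtx C (cprev (root v))  ≡⟨ sym (parent-cycle (root v)) ⟩
        parent (vtx C (root v)) ≡⟨ cong parent (on-cycle v dv) ⟩
        parent v                ≡⟨ p ⟩
        vtx C j                 ∎)
    by-depth (suc k) dv = inj₂ (trans dv (cong suc k≡0) , trans (sym (root-parent v dv)) (trans (cong root p) (root-cycle j)))
      where
      k≡0 : k ≡ 0
      k≡0 = trans (sym (depth-parent v dv)) (trans (cong depth p) (depth-cycle j))

  -- The parent of a cycle vertex is on the cycle, so a vertex whose parent is off the cycle lies one level deeper.
  child-of-tree : ∀ v {k} → depth (parent v) ≡ suc k → depth v ≡ suc (suc k)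
  child-of-tree v {k} dp = by-depth (depth v) refl
    where
    by-depth : ∀ d → depth v ≡ d → depth v ≡ suc (suc k)
    by-depth zero dv with () ← begin
      0                                ≡⟨ sym (depth-cycle (cprev (root v))) ⟩
      depth (vtx C (cprev (root v)))   ≡⟨ cong depth (sym (parent-cycle (root v))) ⟩
      depth (parent (vtx C (root v)))  ≡⟨ cong (λ w → depth (parent w)) (on-cycle v dv) ⟩
      depth (parent v)                 ≡⟨ dp ⟩
      suc k                            ∎
    by-depth (suc j) dv = trans dv (cong suc (trans (sym (depth-parent v dv)) dp))

-- Three consecutive edges
-- have lower ends in grandparent or uncle position, so these two conditions
-- make the colouring injective.
module ParentColouring (G : Graph) (parent : Fin (n G) → Fin (n G))
  (parent-edge : ∀ {x y} → Adj G x y → parent x ≡ y ⊎ parent y ≡ x)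
  {k : ℕ} (c : Fin (n G) → Fin (suc k))
  (grandparent : ∀ a → c a ≢ c (parent (parent a)))
  (uncle : ∀ a b → parent a ≡ parent (parent b) → a ≢ parent b → c a ≢ c b) where

  -- pairs which are not parent edges get an arbitrary colour
  edgeColour : Fin (n G) → Fin (n G) → Fin (suc k)
  edgeColour x y with parent y ≟ x | parent x ≟ y
  ... | yes _ | _ = c y
  ... | no _ | yes _ = c x
  ... | no _ | no _ = zero

  no-2-cycle : ∀ a → parent (parent a) ≢ a
  no-2-cycle a e = grandparent a (cong c (sym e))

  edgeColour-down : ∀ {x y} → parent y ≡ x → edgeColour x y ≡ c y
  edgeColour-down {x} {y} yx with parent y ≟ x | parent x ≟ y
  ... | yes _ | _ = refl
  ... | no ¬yx | _ = ⊥-elim (¬yx yx)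

  edgeColour-up : ∀ {x y} → parent x ≡ y → edgeColour x y ≡ c x
  edgeColour-up {x} {y} xy with parent y ≟ x | parent x ≟ y
  ... | yes yx | _ = ⊥-elim (no-2-cycle x (trans (cong parent xy) yx))
  ... | no _ | yes _ = refl
  ... | no _ | no ¬xy = ⊥-elim (¬xy xy)

  edgeColour-sym : ∀ x y → edgeColour x y ≡ edgeColour y x
  edgeColour-sym x y with parent y ≟ x | parent x ≟ y
  ... | yes yx | yes xy = ⊥-elim (no-2-cycle x (trans (cong parent xy) yx))
  ... | yes _ | no _ = refl
  ... | no _ | yes _ = refl
  ... | no _ | no _ = refl

  differ : ∀ {x y z u a b} → edgeColour x y ≡ c a → edgeColour z u ≡ c b → c a ≢ c b →
           edgeColour x y ≢ edgeColour z u
  differ ea eb ab e = ab (trans (sym ea) (trans e eb))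

  -- Since y and z each have a
  -- single parent, a turn "down, then up" at y or at z would force x = z or
  -- y = u; the four remaining shapes are a grandparent or an uncle pair.
  injective : ∀ x y z u → Adj G x y → Adj G y z → Adj G z u → x ≢ z → y ≢ u →
              edgeColour x y ≢ edgeColour z u
  injective x y z u xy yz zu x≢z y≢u with parent-edge xy | parent-edge yz | parent-edge zu
  ... | inj₂ yx | inj₁ yz′ | _ = ⊥-elim (x≢z (trans (sym yx) yz′))
  ... | _ | inj₂ zy | inj₁ zu′ = ⊥-elim (y≢u (trans (sym zy) zu′))
  ... | inj₁ xy′ | inj₁ yz′ | inj₁ zu′ =
    differ (edgeColour-up xy′) (edgeColour-up zu′)
      (subst (λ w → c x ≢ c w) (trans (cong parent xy′) yz′) (grandparent x))
  ... | inj₁ xy′ | inj₁ yz′ | inj₂ uz =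
    differ (edgeColour-up xy′) (edgeColour-down uz)
      (λ e → uncle u x (trans uz (sym (trans (cong parent xy′) yz′))) (λ u≡ → y≢u (sym (trans u≡ xy′))) (sym e))
  ... | inj₁ xy′ | inj₂ zy | inj₂ uz =
    differ (edgeColour-up xy′) (edgeColour-down uz)
      (uncle x u (trans xy′ (sym (trans (cong parent uz) zy))) (λ x≡ → x≢z (trans x≡ uz)))
  ... | inj₂ yx | inj₂ zy | inj₂ uz =
    differ (edgeColour-down yx) (edgeColour-down uz)
      (λ e → subst (λ w → c u ≢ c w) (trans (cong parent uz) zy) (grandparent u) (sym e))

  colouring : HasInjColouring G (suc k)
  colouring = record { col = edgeColour ; csym = edgeColour-sym } , injective

-- A colour scheme for a cycle of length suc m with k colours: colour i d is
-- the colour of a vertex at depth d below the cycle vertex vᵢ.  The fields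
-- are exactly the grandparent and uncle conditions, sorted by how the
-- vertices involved sit relative to the cycle.
record Scheme (m k : ℕ) : Set where
  field
    colour      : Fin (suc m) → ℕ → Fin k
    -- inside one tree
    deep-two    : ∀ i d → colour i (2 + d) ≢ colour i d
    deep-one    : ∀ i d → colour i (1 + d) ≢ colour i (2 + d)
    -- grandparents on the cycle
    back-one    : ∀ j → colour (cnext j) 1 ≢ colour j 0
    back-two    : ∀ j → colour (cnext (cnext j)) 0 ≢ colour j 0
    -- uncles around the cycle
    cousins     : ∀ j → colour j 1 ≢ colour (cnext j) 1
    uncle-cycle : ∀ j → colour (cnext j) 0 ≢ colour j 2
    uncle-leaf  : ∀ j → colour j 1 ≢ colour (cnext (cnext j)) 0

module SchemeColouring {G : Graph} {C : Cycle G} (F : CycleForest G C) {k : ℕ} (S : Scheme (m C) k) where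
  open CycleForest F
  open Forest F
  open Scheme S

  vertexColour : Fin (n G) → Fin k
  vertexColour v = colour (root v) (depth v)

  colour-at : ∀ v {i d} → root v ≡ i → depth v ≡ d → vertexColour v ≡ colour i d
  colour-at v = cong₂ colour

  colour-on-cycle : ∀ {v} i → v ≡ vtx C i → vertexColour v ≡ colour i 0
  colour-on-cycle i refl = colour-at (vtx C i) (root-cycle i) (depth-cycle i)

  colour-grandparent : ∀ a {d} → depth a ≡ suc (suc d) → vertexColour (parent (parent a)) ≡ colour (root a) d
  colour-grandparent a da = colour-at (parent (parent a))
    (trans (root-parent (parent a) (depth-parent a da)) (root-parent a da))
    (depth-parent (parent a) (depth-parent a da))

  differ : ∀ {a b i j d e} → vertexColour a ≡ colour i d → vertexColour b ≡ colour j e →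
           colour i d ≢ colour j e → vertexColour a ≢ vertexColour b
  differ ea eb ne e = ne (trans (sym ea) (trans e eb))

  grandparent : ∀ a → vertexColour a ≢ vertexColour (parent (parent a))
  grandparent a = by-depth (depth (parent (parent a))) refl
    where
    by-depth : ∀ d → depth (parent (parent a)) ≡ d → vertexColour a ≢ vertexColour (parent (parent a))
    by-depth (suc d) dg = differ (colour-at a refl da) (colour-grandparent a da) (deep-two (root a) (suc d))
      where
      da : depth a ≡ suc (suc (suc d))
      da = child-of-tree a (child-of-tree (parent a) dg)
    by-depth zero dg = by-parent (child-of-cycle (parent a) j g≡)
      where
      j : Fin (suc (m C))
      j = root (parent (parent a))
      g≡ : parent (parent a) ≡ vtx C j
      g≡ = sym (on-cycle (parent (parent a)) dg)
      g-colour : vertexColour (parent (parent a)) ≡ colour j 0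
      g-colour = colour-on-cycle j g≡
      by-self : a ≡ vtx C (cnext (cnext j)) ⊎ (depth a ≡ 1 × root a ≡ cnext j) →
                vertexColour a ≢ vertexColour (parent (parent a))
      by-self (inj₁ a≡) = differ (colour-on-cycle (cnext (cnext j)) a≡) g-colour (back-two j)
      by-self (inj₂ (d1 , r1)) = differ (colour-at a r1 d1) g-colour (back-one j)
      by-parent : parent a ≡ vtx C (cnext j) ⊎ (depth (parent a) ≡ 1 × root (parent a) ≡ j) →
                  vertexColour a ≢ vertexColour (parent (parent a))
      by-parent (inj₁ pa≡) = by-self (child-of-cycle a (cnext j) pa≡)
      by-parent (inj₂ (d1 , r1)) =
        differ (colour-at a (trans (sym (root-parent a da)) r1) da) g-colour (deep-two j 0)
        where
        da : depth a ≡ 2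
        da = child-of-tree a d1

  uncle : ∀ a b → parent a ≡ parent (parent b) → a ≢ parent b → vertexColour a ≢ vertexColour b
  uncle a b pa≡ppb a≢pb = by-depth (depth (parent a)) refl
    where
    by-depth : ∀ d → depth (parent a) ≡ d → vertexColour a ≢ vertexColour b
    by-depth (suc d) dg = differ (colour-at a refl da) (colour-at b rb db) (deep-one (root a) (suc d))
      where
      da : depth a ≡ suc (suc d)
      da = child-of-tree a dg
      dpb : depth (parent b) ≡ suc (suc d)
      dpb = child-of-tree (parent b) (trans (cong depth (sym pa≡ppb)) dg)
      db : depth b ≡ suc (suc (suc d))
      db = child-of-tree b dpb
      rb : root b ≡ root a
      rb = begin
        root b                   ≡⟨ sym (root-parent b db) ⟩
        root (parent b)          ≡⟨ sym (root-parent (parent b) dpb) ⟩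
        root (parent (parent b)) ≡⟨ cong root (sym pa≡ppb) ⟩
        root (parent a)          ≡⟨ root-parent a da ⟩
        root a                   ∎
    by-depth zero dg = by-positions (child-of-cycle a j g≡) (child-of-cycle (parent b) j (trans (sym pa≡ppb) g≡))
      where
      j : Fin (suc (m C))
      j = root (parent a)
      g≡ : parent a ≡ vtx C j
      g≡ = sym (on-cycle (parent a) dg)
      b-deep : depth (parent b) ≡ 1 → root (parent b) ≡ j → vertexColour b ≡ colour j 2
      b-deep d1 r1 = colour-at b (trans (sym (root-parent b db)) r1) db
        where
        db : depth b ≡ 2
        db = child-of-tree b d1
      by-positions : a ≡ vtx C (cnext j) ⊎ (depth a ≡ 1 × root a ≡ j) →
                     parent b ≡ vtx C (cnext j) ⊎ (depth (parent b) ≡ 1 × root (parent b) ≡ j) →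
                     vertexColour a ≢ vertexColour b
      by-positions (inj₁ a≡) (inj₁ pb≡) = ⊥-elim (a≢pb (trans a≡ (sym pb≡)))
      by-positions (inj₁ a≡) (inj₂ (d1 , r1)) = differ (colour-on-cycle (cnext j) a≡) (b-deep d1 r1) (uncle-cycle j)
      by-positions (inj₂ (d1 , r1)) (inj₂ (d1′ , r1′)) = differ (colour-at a r1 d1) (b-deep d1′ r1′) (deep-one j 0)
      by-positions (inj₂ (d1 , r1)) (inj₁ pb≡) with child-of-cycle b (cnext j) pb≡
      ... | inj₁ b≡ = differ (colour-at a r1 d1) (colour-on-cycle (cnext (cnext j)) b≡) (uncle-leaf j)
      ... | inj₂ (d1′ , r1′) = differ (colour-at a r1 d1) (colour-at b r1′ d1′) (cousins j)

-- In a graph whose only cycle is C, every edge of a forest hanging from C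
-- joins a vertex to its parent: otherwise the walk up from x to v₀ and back
-- down to y, loop-erased and closed by the edge yx, would be a cycle
-- containing the edge {x, y}, which is therefore an edge of C — but the
-- edges of C are parent edges.
module ParentEdges {G : Graph} {C : Cycle G} (F : CycleForest G C)
  (only-cycle : ∀ (D : Cycle G) → SameCycle C D) where
  open CycleForest F
  open Forest F

  ParentEdge : Fin (n G) → Fin (n G) → Set
  ParentEdge a b = parent a ≡ b ⊎ parent b ≡ a

  parentEdge-adj : ∀ {a b} → ParentEdge a b → Adj G a b
  parentEdge-adj {a} (inj₁ refl) = parent-adj a
  parentEdge-adj {a} {b} (inj₂ refl) = adj-sym G (parent-adj b)

  cycle-edge-is-parent-edge : ∀ {x y} → CycleEdge C x y → ParentEdge x y
  cycle-edge-is-parent-edge (i , inj₁ (refl , refl)) = inj₂ (trans (parent-cycle (cnext i)) (cong (vtx C) (cprev-cnext i)))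
  cycle-edge-is-parent-edge (i , inj₂ (refl , refl)) = inj₁ (trans (parent-cycle (cnext i)) (cong (vtx C) (cprev-cnext i)))

  ascent : ℕ → Fin (n G) → List (Fin (n G))
  ascent zero v = []
  ascent (suc k) v = parent v ∷ ascent k (parent v)

  ascent-walk : ∀ k v → Linked ParentEdge (v ∷ ascent k v)
  ascent-walk zero v = [-]
  ascent-walk (suc k) v = inj₁ refl ∷ ascent-walk k (parent v)

  ascent-end : ∀ k v → end v (ascent k v) ≡ ancestor k v
  ascent-end zero v = refl
  ascent-end (suc k) v = ascent-end k (parent v)

  descent : ℕ → Fin (n G) → List (Fin (n G))
  descent zero v = []
  descent (suc k) v = descent k (parent v) ++ v ∷ []

  descent-end : ∀ k v → end (ancestor k v) (descent k v) ≡ v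
  descent-end zero v = refl
  descent-end (suc k) v = trans (end-++ (ancestor k (parent v)) (descent k (parent v)) (v ∷ []))
                                (cong (λ w → end w (v ∷ [])) (descent-end k (parent v)))

  descent-walk : ∀ k v → Linked ParentEdge (ancestor k v ∷ descent k v)
  descent-walk zero v = [-]
  descent-walk (suc k) v = linked-++ (descent k (parent v)) (descent-walk k (parent v))
    (subst (λ w → Linked ParentEdge (w ∷ v ∷ [])) (sym (descent-end k (parent v))) (inj₂ refl ∷ [-]))

  ancestor-+ : ∀ a b v → ancestor (a + b) v ≡ ancestor b (ancestor a v)
  ancestor-+ zero b v = refl
  ancestor-+ (suc a) b v = ancestor-+ a b (parent v)

  ancestor-cycle : ∀ k i → toℕ i ≡ k → ancestor k (vtx C i) ≡ vtx C zero
  ancestor-cycle zero zero _ = refl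
  ancestor-cycle (suc k) (suc i) i≡k = begin
    ancestor k (parent (vtx C (suc i))) ≡⟨ cong (ancestor k) (parent-cycle (suc i)) ⟩
    ancestor k (vtx C (inject₁ i))      ≡⟨ ancestor-cycle k (inject₁ i) (trans (toℕ-inject₁ i) (suc-injective i≡k)) ⟩
    vtx C zero                          ∎

  reaches-v₀ : ∀ v → ∃[ k ] ancestor k v ≡ vtx C zero
  reaches-v₀ v = depth v + toℕ (root v) , (begin
    ancestor (depth v + toℕ (root v)) v           ≡⟨ ancestor-+ (depth v) (toℕ (root v)) v ⟩
    ancestor (toℕ (root v)) (ancestor (depth v) v) ≡⟨ cong (ancestor (toℕ (root v))) (sym (root-spec v)) ⟩
    ancestor (toℕ (root v)) (vtx C (root v))      ≡⟨ ancestor-cycle (toℕ (root v)) (root v) refl ⟩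
    vtx C zero                                    ∎)

  walk-between : ∀ x y → ∃[ t ] (Linked ParentEdge (x ∷ t) × end x t ≡ y)
  walk-between x y = ascent kx x ++ descent ky y , walk , ends
    where
    kx ky : ℕ
    kx = proj₁ (reaches-v₀ x)
    ky = proj₁ (reaches-v₀ y)
    meet : end x (ascent kx x) ≡ ancestor ky y
    meet = trans (ascent-end kx x) (trans (proj₂ (reaches-v₀ x)) (sym (proj₂ (reaches-v₀ y))))
    walk : Linked ParentEdge (x ∷ ascent kx x ++ descent ky y)
    walk = linked-++ (ascent kx x) (ascent-walk kx x)
             (subst (λ w → Linked ParentEdge (w ∷ descent ky y)) (sym meet) (descent-walk ky y))
    ends : end x (ascent kx x ++ descent ky y) ≡ y
    ends = trans (end-++ x (ascent kx x) (descent ky y))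
                 (trans (cong (λ w → end w (descent ky y)) meet) (descent-end ky y))

  open LoopErasure {Fin (n G)} _≟_ {ParentEdge}

  parentEdge? : ∀ a b → Dec (ParentEdge a b)
  parentEdge? a b = (parent a ≟ b) ⊎-dec (parent b ≟ a)

  no-other-edge : ∀ {x y} → Adj G x y → ¬ ParentEdge x y → ⊥
  no-other-edge {x} {y} xy not-parent-edge with walk-between x y
  ... | t , walk , ends = by-erased-walk (loopErase x t) (loopErase-simple x t walk)
    where
    by-erased-walk : ∀ s → Linked ParentEdge (x ∷ s) × Unique (x ∷ s) × end x s ≡ end x t → ⊥
    by-erased-walk [] (_ , _ , e) = adj-irrefl G xy (trans e ends)
    by-erased-walk (z ∷ []) ((p ∷ [-]) , _ , e) = not-parent-edge (subst (ParentEdge x) (trans e ends) p)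
    by-erased-walk s@(_ ∷ _ ∷ _) (w , u , e) =
      not-parent-edge (cycle-edge-is-parent-edge (subst (CycleEdge C x) (trans e ends) edge-of-C))
      where
      closing : Adj G (end x s) x
      closing = subst (λ v → Adj G v x) (sym (trans e ends)) (adj-sym G xy)
      open ClosePath G s (Linked.map parentEdge-adj w) u closing (s≤s (s≤s z≤n))
      edge-of-C : CycleEdge C x (end x s)
      edge-of-C = proj₂ (only-cycle cycle x (end x s)) closing-edge

  every-edge-is-parent-edge : ∀ {x y} → Adj G x y → ParentEdge x y
  every-edge-is-parent-edge {x} {y} xy with parentEdge? x y
  ... | yes pe = pe
  ... | no ¬pe = ⊥-elim (no-other-edge xy ¬pe)

-- A profile lists the colours used at depths 0, 1, 2, 3 of one tree;
-- deeper levels repeat the colours of depths 1, 2, 3 with period three.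
record Profile : Set where
  constructor profile
  field
    at0 at1 at2 at3 : Fin 4
open Profile

colourAt : Profile → ℕ → Fin 4
colourAt p 0 = at0 p
colourAt p 1 = at1 p
colourAt p 2 = at2 p
colourAt p 3 = at3 p
colourAt p (suc (suc (suc (suc d)))) = colourAt p (suc d)

Proper : Profile → Set
Proper p = at1 p ≢ at2 p × at2 p ≢ at3 p × at3 p ≢ at1 p × at2 p ≢ at0 p

-- the conditions between the trees at vⱼ and vⱼ₊₁
Adjacent : Profile → Profile → Set
Adjacent p q = at1 q ≢ at0 p × at1 p ≢ at1 q × at0 q ≢ at2 p

-- the conditions between the trees at vⱼ and vⱼ₊₂
Distant : Profile → Profile → Set
Distant p r = at0 r ≢ at0 p × at1 p ≢ at0 r

proper? : ∀ p → Dec (Proper p)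
proper? p = ¬? (at1 p ≟ at2 p) ×-dec ¬? (at2 p ≟ at3 p) ×-dec ¬? (at3 p ≟ at1 p) ×-dec ¬? (at2 p ≟ at0 p)

adjacent? : ∀ p q → Dec (Adjacent p q)
adjacent? p q = ¬? (at1 q ≟ at0 p) ×-dec ¬? (at1 p ≟ at1 q) ×-dec ¬? (at0 q ≟ at2 p)

distant? : ∀ p r → Dec (Distant p r)
distant? p r = ¬? (at0 r ≟ at0 p) ×-dec ¬? (at1 p ≟ at0 r)

proper-deep-one : ∀ {p} → Proper p → ∀ d → colourAt p (1 + d) ≢ colourAt p (2 + d)
proper-deep-one (c₁≢c₂ , _ , _ , _) 0 = c₁≢c₂
proper-deep-one (_ , c₂≢c₃ , _ , _) 1 = c₂≢c₃
proper-deep-one (_ , _ , c₃≢c₁ , _) 2 = c₃≢c₁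
proper-deep-one pp (suc (suc (suc d))) = proper-deep-one pp d

proper-deep-two : ∀ {p} → Proper p → ∀ d → colourAt p (2 + d) ≢ colourAt p d
proper-deep-two (_ , _ , _ , c₂≢c₀) 0 = c₂≢c₀
proper-deep-two (_ , _ , c₃≢c₁ , _) 1 = c₃≢c₁
proper-deep-two pp (suc (suc d)) = proper-deep-one pp d

mod3 : ℕ → Fin 3
mod3 zero = 0F
mod3 (suc k) = cnext (mod3 k)

-- Along the cycle the profiles repeat with period three; the profiles at
-- indices 0 and 1 are patched, depending on m mod 3, so that the sequence
-- closes up.  Colour 3 is used only in the patch at index 1.
periodic : Fin 3 → Profile
periodic 0F = profile 0F 0F 1F 2F
periodic 1F = profile 2F 2F 0F 1F
periodic 2F = profile 1F 1F 2F 0F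

patch₀ : Fin 3 → Profile
patch₀ 0F = profile 0F 2F 1F 0F
patch₀ 1F = profile 2F 0F 1F 2F
patch₀ 2F = profile 0F 0F 1F 2F

patch₁ : Fin 3 → Profile
patch₁ 0F = profile 2F 3F 0F 1F
patch₁ 1F = profile 3F 3F 0F 1F
patch₁ 2F = profile 2F 2F 0F 1F

profileAt : ℕ → ℕ → Profile
profileAt m 0 = patch₀ (mod3 m)
profileAt m 1 = patch₁ (mod3 m)
profileAt m (suc (suc k)) = periodic (mod3 (suc (suc k)))

periodic-proper : ∀ y → Proper (periodic y)
periodic-proper = from-yes (all? λ y → proper? (periodic y))

patch₀-proper : ∀ y → Proper (patch₀ y)
patch₀-proper = from-yes (all? λ y → proper? (patch₀ y))

patch₁-proper : ∀ y → Proper (patch₁ y)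
patch₁-proper = from-yes (all? λ y → proper? (patch₁ y))

periodic-adjacent : ∀ y → Adjacent (periodic y) (periodic (cnext y))
periodic-adjacent = from-yes (all? λ y → adjacent? (periodic y) (periodic (cnext y)))

wrap-adjacent : ∀ y → Adjacent (periodic y) (patch₀ y)
wrap-adjacent = from-yes (all? λ y → adjacent? (periodic y) (patch₀ y))

patch-adjacent₀₁ : ∀ y → Adjacent (patch₀ y) (patch₁ y)
patch-adjacent₀₁ = from-yes (all? λ y → adjacent? (patch₀ y) (patch₁ y))

patch-adjacent₁₂ : ∀ y → Adjacent (patch₁ y) (periodic 2F)
patch-adjacent₁₂ = from-yes (all? λ y → adjacent? (patch₁ y) (periodic 2F))

periodic-distant : ∀ y → Distant (periodic y) (periodic (cnext (cnext y)))
periodic-distant = from-yes (all? λ y → distant? (periodic y) (periodic (cnext (cnext y))))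

wrap-distant₀ : ∀ y → Distant (periodic y) (patch₀ (cnext y))
wrap-distant₀ = from-yes (all? λ y → distant? (periodic y) (patch₀ (cnext y)))

wrap-distant₁ : ∀ y → Distant (periodic y) (patch₁ y)
wrap-distant₁ = from-yes (all? λ y → distant? (periodic y) (patch₁ y))

patch-distant₀₂ : ∀ y → Distant (patch₀ y) (periodic 2F)
patch-distant₀₂ = from-yes (all? λ y → distant? (patch₀ y) (periodic 2F))

patch-distant₁₃ : ∀ y → Distant (patch₁ y) (periodic 0F)
patch-distant₁₃ = from-yes (all? λ y → distant? (patch₁ y) (periodic 0F))

profileAt-proper : ∀ m k → Proper (profileAt m k)
profileAt-proper m 0 = patch₀-proper (mod3 m)
profileAt-proper m 1 = patch₁-proper (mod3 m)
profileAt-proper m (suc (suc k)) = periodic-proper (mod3 (suc (suc k)))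

adjacent-step : ∀ m k → Adjacent (profileAt m k) (profileAt m (suc k))
adjacent-step m 0 = patch-adjacent₀₁ (mod3 m)
adjacent-step m 1 = patch-adjacent₁₂ (mod3 m)
adjacent-step m (suc (suc k)) = periodic-adjacent (mod3 (suc (suc k)))

distant-step : ∀ m k → Distant (profileAt m k) (profileAt m (suc (suc k)))
distant-step m 0 = patch-distant₀₂ (mod3 m)
distant-step m 1 = patch-distant₁₃ (mod3 m)
distant-step m (suc (suc k)) = periodic-distant (mod3 (suc (suc k)))

profileOf : ∀ {m} → Fin (suc m) → Profile
profileOf {m} i = profileAt m (toℕ i)

adjacent-profiles : ∀ {m} → 3 ≤ m → ∀ i → Adjacent (profileOf {m} (cprev i)) (profileOf i)
adjacent-profiles {suc (suc (suc m))} _ zero rewrite toℕ-fromℕ m =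
  wrap-adjacent (mod3 (suc (suc (suc m))))
adjacent-profiles {1} (s≤s ()) zero
adjacent-profiles {2} (s≤s (s≤s ())) zero
adjacent-profiles {m} _ (suc j) rewrite toℕ-inject₁ j = adjacent-step m (toℕ j)

distant-profiles : ∀ {m} → 3 ≤ m → ∀ i → Distant (profileOf {m} (cprev (cprev i))) (profileOf i)
distant-profiles {suc (suc (suc m))} _ zero rewrite toℕ-inject₁ (fromℕ m) | toℕ-fromℕ m =
  wrap-distant₀ (mod3 (suc (suc m)))
distant-profiles {suc (suc (suc m))} _ (suc zero) rewrite toℕ-fromℕ m =
  wrap-distant₁ (mod3 (suc (suc (suc m))))
distant-profiles {1} (s≤s ()) _
distant-profiles {2} (s≤s (s≤s ())) _
distant-profiles {suc (suc m)} _ (suc (suc j)) rewrite toℕ-inject₁ (inject₁ j) | toℕ-inject₁ j =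
  distant-step (suc (suc m)) (toℕ j)

forward : ∀ {m} (P : Fin (suc m) → Fin (suc m) → Set) → (∀ i → P (cprev i) i) → ∀ j → P j (cnext j)
forward P back j = subst (λ i → P i (cnext j)) (cprev-cnext j) (back (cnext j))

forward₂ : ∀ {m} (P : Fin (suc m) → Fin (suc m) → Set) → (∀ i → P (cprev (cprev i)) i) →
           ∀ j → P j (cnext (cnext j))
forward₂ P back j = subst (λ i → P i (cnext (cnext j)))
  (trans (cong cprev (cprev-cnext (cnext j))) (cprev-cnext j)) (back (cnext (cnext j)))

scheme : ∀ {m} → 3 ≤ m → Scheme m 4
scheme {m} 3≤m = record
  { colour      = λ i → colourAt (profileOf i)
  ; deep-two    = λ i → proper-deep-two (profileAt-proper m (toℕ i))
  ; deep-one    = λ i → proper-deep-one (profileAt-proper m (toℕ i))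
  ; back-one    = λ j → proj₁ (adjacent j)
  ; back-two    = λ j → proj₁ (distant j)
  ; cousins     = λ j → proj₁ (proj₂ (adjacent j))
  ; uncle-cycle = λ j → proj₂ (proj₂ (adjacent j))
  ; uncle-leaf  = λ j → proj₂ (distant j) }
  where
  adjacent : ∀ j → Adjacent (profileOf j) (profileOf (cnext j))
  adjacent = forward (λ i j → Adjacent (profileOf i) (profileOf j)) (adjacent-profiles 3≤m)
  distant : ∀ j → Distant (profileOf j) (profileOf (cnext (cnext j)))
  distant = forward₂ (λ i j → Distant (profileOf i) (profileOf j)) (distant-profiles 3≤m)

module BreadthFirst (G : Graph) (C : Cycle G) (connected : Connected G) where

  Within : ℕ → Fin (n G) → Set
  Within zero v = ∃[ i ] vtx C i ≡ v
  Within (suc k) v = Within k v ⊎ ∃[ w ] (Adj G v w × Within k w)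

  within? : ∀ k v → Dec (Within k v)
  within? zero v = any? (λ i → vtx C i ≟ v)
  within? (suc k) v = within? k v ⊎-dec any? (λ w → (adj G v w ≟ᵇ true) ×-dec within? k w)

  walk-within : ∀ {u v} → Walk G u v → Within 0 v → ∃[ k ] Within k u
  walk-within here w = 0 , w
  walk-within (step {w = x} uw rest) w with walk-within rest w
  ... | k , within = suc k , inj₂ (x , uw , within)

  nearest : ∀ v → Least (λ k → Within k v)
  nearest v = least (λ k → within? k v) (proj₂ (walk-within (connected v (vtx C zero)) (zero , refl)))

  depth : Fin (n G) → ℕ
  depth v = Least.value (nearest v)

  depth-least : ∀ {k v} → Within k v → depth v ≤ k
  depth-least {k} {v} w = ≮⇒≥ (λ k<depth → Least.below (nearest v) k<depth w)

  Minimal : ℕ → Fin (n G) → Set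
  Minimal k v = ∀ {j} → j < k → ¬ Within j v

  next : ∀ v {k} → Within k v → Minimal k v → Fin (n G)
  next v {zero} (i , _) _ = vtx C (cprev i)
  next v {suc k} (inj₁ w) minimal = ⊥-elim (minimal (n<1+n k) w)
  next v {suc k} (inj₂ (w , _ , _)) _ = w

  parent : Fin (n G) → Fin (n G)
  parent v = next v (Least.holds (nearest v)) (Least.below (nearest v))

  next-adj : ∀ v {k} (w : Within k v) (minimal : Minimal k v) → Adj G v (next v w minimal)
  next-adj v {zero} (i , refl) _ =
    adj-sym G (subst (λ j → Adj G (vtx C (cprev i)) (vtx C j)) (cnext-cprev i) (closed C (cprev i)))
  next-adj v {suc k} (inj₁ w) minimal = ⊥-elim (minimal (n<1+n k) w)
  next-adj v {suc k} (inj₂ (_ , vw , _)) _ = vw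

  next-depth : ∀ v {k} (w : Within (suc k) v) (minimal : Minimal (suc k) v) → depth (next v w minimal) ≡ k
  next-depth v {k} (inj₁ w) minimal = ⊥-elim (minimal (n<1+n k) w)
  next-depth v {k} (inj₂ (x , vx , wx)) minimal = ≤-antisym (depth-least wx)
    (s≤s⁻¹ (≮⇒≥ (λ shorter → minimal shorter (inj₂ (x , vx , Least.holds (nearest x))))))

  next-cycle : ∀ i {k} (w : Within k (vtx C i)) (minimal : Minimal k (vtx C i)) → k ≡ 0 → next (vtx C i) w minimal ≡ vtx C (cprev i)
  next-cycle i {.zero} (j , e) _ refl = cong (λ x → vtx C (cprev x)) (inj C e)

  depth-cycle : ∀ i → depth (vtx C i) ≡ 0
  depth-cycle i = n≤0⇒n≡0 (depth-least {0} (i , refl))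

  depth-parent : ∀ v {k} → depth v ≡ suc k → depth (parent v) ≡ k
  depth-parent v {k} dv = at-depth (Least.holds (nearest v)) (Least.below (nearest v)) dv
    where
    at-depth : ∀ {d} (w : Within d v) (minimal : Minimal d v) → d ≡ suc k → depth (next v w minimal) ≡ k
    at-depth {.(suc k)} w minimal refl = next-depth v w minimal

  forest : CycleForest G C
  forest = record
    { parent       = parent
    ; depth        = depth
    ; parent-adj   = λ v → next-adj v (Least.holds (nearest v)) (Least.below (nearest v))
    ; parent-cycle = λ i → next-cycle i (Least.holds (nearest (vtx C i))) (Least.below (nearest (vtx C i))) (depth-cycle i)
    ; depth-cycle  = depth-cycle
    ; depth-zero   = λ v d0 → subst (λ k → Within k v) d0 (Least.holds (nearest v))
    ; depth-parent = depth-parent }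

needs-two-colours : ∀ {G : Graph} {x y z u} → Adj G x y → Adj G y z → Adj G z u → x ≢ z → y ≢ u →
                    ¬ HasInjColouring G 1
needs-two-colours {x = x} {y} {z} {u} xy yz zu x≢z y≢u (c , injective) =
  injective x y z u xy yz zu x≢z y≢u (single (col c x y) (col c z u))
  where
  single : (a b : Fin 1) → a ≡ b
  single zero zero = refl

cycle-needs-two-colours : ∀ {G : Graph} (C : Cycle G) → 4 ≤ len C → ¬ HasInjColouring G 1
cycle-needs-two-colours {G} C 4≤len with m C | vtx C | inj C | closed C | 4≤len
... | _ | v | v-inj | v-closed | s≤s (s≤s (s≤s (s≤s _))) =
  needs-two-colours (v-closed 0F) (v-closed 1F) (v-closed 2F) (λ e → case v-inj e of λ ()) (λ e → case v-inj e of λ ())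

proposition17 : (G : Graph) (C : Cycle G) → UnicyclicWith G C → 4 ≤ len C →
                HasInjColouring G 4 × ¬ HasInjColouring G 1
proposition17 G C (connected , only-cycle) 4≤len@(s≤s 3≤m) =
  four-colours , cycle-needs-two-colours C 4≤len
  where
  F : CycleForest G C
  F = BreadthFirst.forest G C connected
  open CycleForest F using (parent)
  open ParentEdges F only-cycle using (every-edge-is-parent-edge)
  open SchemeColouring F (scheme 3≤m) using (vertexColour; grandparent; uncle)
  four-colours : HasInjColouring G 4
  four-colours = ParentColouring.colouring G parent every-edge-is-parent-edge vertexColour grandparent uncle
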